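{- Let $G=(V,E)$ be an undirected graph with edge costs $c:E\to\mathbb{R}_{\ge0}$, let $W\subseteq V$ be a set of $k=|W|$ terminals, and let $i\in W$. Consider the sVPND instance $(G,c,W,b)$ with $b(j)=1$ for all $j\in W$ and the PR instance $(G,c,W,i)$. Then any tree solution to the sVPND instance yields a tree solution of the same cost to the PR instance, and vice versa. Concretely: for any subtree $T$ of $G$ containing all terminals, letting $P_{jl}$ be the unique $j$-$l$-path in $T$ and $\mathcal{P}_i=\{P_{ij}\mid j\in W\setminus\{i\}\}$, the sVPND tree solution on $T$ (with capacities $u(e)=\min\{n(e,\mathcal{P}_i),k-n(e,\mathcal{P}_i)\}$ for $e\in T$, i.e. the minimum number of terminals on either side of $e$ in $T$, and $u(e)=0$ otherwise) has cost $\sum_{e\in E}c(e)u(e)=\sum_{e\in E}c(e)\,y(e,\mathcal{P}_i)$, which is the PR cost of $\mathcal{P}_i$; and conversely every tree solution of the PR instance arises in this way from the tree formed by its paths.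
   Context: sVPND instance: as usual, a virtual private network consists of an $i$-$j$-path $P_{ij}$ for each pair of distinct terminals and capacities $u(e)\ge0$ such that every valid demand set $D$ (demands $d_{ij}\ge0$ with $\sum_j d_{ij}\le b(i)$) satisfies $u(e)\ge\sum_{\{i,j\}:e\in P_{ij}}d_{ij}$ for all $e$; its cost is $\sum_e c(e)u(e)$. A tree solution is a feasible virtual private network whose capacity support is a tree; in a tree solution capacities are chosen minimal, i.e. for a tree edge $e$, $u(e)$ is the minimum, over the two components of the tree minus $e$, of the total bound $b$ of terminals in that component. Pyramidal Routing (PR) instance $(G,c,W,i)$ with source terminal $i\in W$: a solution is a set $\mathcal{P}_i$ of simple $i$-$j$-paths $P_{ij}$, one for each $j\in W\setminus\{i\}$. For $e\in E$ let $n(e,\mathcal{P}_i)=|\{j\in W\setminus\{i\}: e\in P_{ij}\}|$ and $y(e,\mathcal{P}_i)=\min\{n(e,\mathcal{P}_i),k-n(e,\mathcal{P}_i)\}$, where $k=|W|$. The cost of $\mathcal{P}_i$ is $\sum_{e\in E}c(e)\,y(e,\mathcal{P}_i)$, to be minimized. A tree solution of PR is a solution whose paths together form a tree. -}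

module Defs where

open import Level using (Level; 0ℓ)
open import Data.Nat using (ℕ; _∸_; _⊓_)
open import Data.Fin using (Fin)
open import Data.Fin.Subset using (Subset; ∣_∣) renaming (_∈_ to _∈ₛ_)
open import Data.Fin.Subset.Properties using () renaming (_∈?_ to _∈ₛ?_)
open import Data.List using (List; []; _∷_) renaming (map to mapᴸ)
open import Data.Nat.ListAction using () renaming (sum to sumᴸ)
open import Data.List.Base using (length)
open import Data.List.Membership.Propositional using (_∈_; _∉_)
open import Data.List.Relation.Unary.Unique.Propositional using (Unique)
open import Data.Fin.Properties using (_≟_)
open import Data.List.Base using (allFin)
open import Data.Product using (Σ; _×_; _,_; ∃)
open import Data.Sum using (_⊎_)
import Data.Empty
open import Relation.Nullary using (¬_; Dec; yes; no)
open import Relation.Binary.PropositionalEquality using (_≡_; _≢_)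
open import Relation.Unary using (Pred; _⊆_)
open import Algebra.Bundles using (CommutativeMonoid)
import Algebra.Definitions.RawMonoid as RM

-- Finite undirected (multi)graphs: vertices Fin n, edges Fin m,
-- edge e joins  src e  and  tgt e  (orientation irrelevant).

record Graph : Set where
  field
    n   : ℕ
    m   : ℕ
    src : Fin m → Fin n
    tgt : Fin m → Fin n

module _ (G : Graph) where
  open Graph G

  Joins : Fin m → Fin n → Fin n → Set
  Joins e u v = (src e ≡ u × tgt e ≡ v) ⊎ (src e ≡ v × tgt e ≡ u)

  data Walk : Fin n → Fin n → Set where
    []   : ∀ {v} → Walk v v
    step : ∀ {u v w} (e : Fin m) → Joins e u v → Walk v w → Walk u w

  edgesOf : ∀ {u w} → Walk u w → List (Fin m)
  edgesOf []            = []
  edgesOf (step e _ p)  = e ∷ edgesOf p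

  vertsOf : ∀ {u w} → Walk u w → List (Fin n)
  vertsOf {u} []           = u ∷ []
  vertsOf {u} (step _ _ p) = u ∷ vertsOf p

  IsSimple : ∀ {u w} → Walk u w → Set
  IsSimple p = Unique (vertsOf p)

  WalkIn : Pred (Fin m) 0ℓ → ∀ {u w} → Walk u w → Set
  WalkIn F p = ∀ {e} → e ∈ edgesOf p → F e

  record IsTree (VT : Pred (Fin n) 0ℓ) (ET : Pred (Fin m) 0ℓ) : Set where
    field
      nonempty  : ∃ VT
      closed    : ∀ {e} → ET e → VT (src e) × VT (tgt e)
      connected : ∀ {v w} → VT v → VT w → Σ (Walk v w) (WalkIn ET)
      -- acyclic: no edge e of T joining u,v together with a simple
      -- v-u path in T avoiding e  (this is exactly a cycle in T)
      acyclic   : ∀ {e u v} → ET e → Joins e u v → (p : Walk v u) →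
                  IsSimple p → WalkIn ET p → e ∉ edgesOf p → Data.Empty.⊥

  -- Instances with terminal set W (unit bounds b ≡ 1) and source i.

  module Instance (W : Subset n) (i : Fin n) where
    open import Data.List.Membership.DecPropositional (_≟_ {m}) using () renaming (_∈?_ to _∈ᴸ?_)

    k : ℕ
    k = ∣ W ∣

    IsTerminalSubtree : Pred (Fin n) 0ℓ → Pred (Fin m) 0ℓ → Set
    IsTerminalSubtree VT ET = IsTree VT ET × (∀ {w} → w ∈ₛ W → VT w)

    PathFamily : Set
    PathFamily = (j : Fin n) → j ∈ₛ W → j ≢ i → Walk i j

    IsPRSolution : PathFamily → Set
    IsPRSolution P = ∀ j (jW : j ∈ₛ W) (ji : j ≢ i) → IsSimple (P j jW ji)

    uses : PathFamily → Fin m → Fin n → ℕ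
    uses P e j with j ∈ₛ? W | j ≟ i
    ... | yes jW | no ji with e ∈ᴸ? edgesOf (P j jW ji)
    ...   | yes _ = 1
    ...   | no _  = 0
    uses P e j | _ | _ = 0

    nLoad : PathFamily → Fin m → ℕ
    nLoad P e = sumᴸ (mapᴸ (uses P e) (allFin n))

    yLoad : PathFamily → Fin m → ℕ
    yLoad P e = nLoad P e ⊓ (k ∸ nLoad P e)

    pathVerts : PathFamily → Pred (Fin n) 0ℓ
    pathVerts P v = v ≡ i ⊎ Σ (Fin n) (λ j → Σ (j ∈ₛ W) (λ jW → Σ (j ≢ i) (λ ji → v ∈ vertsOf (P j jW ji))))

    pathEdges : PathFamily → Pred (Fin m) 0ℓ
    pathEdges P e = Σ (Fin n) (λ j → Σ (j ∈ₛ W) (λ jW → Σ (j ≢ i) (λ ji → e ∈ edgesOf (P j jW ji))))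

    IsPRTreeSolution : PathFamily → Set
    IsPRTreeSolution P = IsPRSolution P × IsTree (pathVerts P) (pathEdges P)

    FamilyIn : Pred (Fin m) 0ℓ → PathFamily → Set
    FamilyIn ET P = ∀ j (jW : j ∈ₛ W) (ji : j ≢ i) → WalkIn ET (P j jW ji)

    IsTerminalSide : Pred (Fin m) 0ℓ → Fin m → Fin n → Subset n → Set
    IsTerminalSide ET e v S =
      ∀ w → (w ∈ₛ S → w ∈ₛ W × Σ (Walk v w) (WalkIn (λ f → ET f × f ≢ e)))
          × (w ∈ₛ W × Σ (Walk v w) (WalkIn (λ f → ET f × f ≢ e)) → w ∈ₛ S)

    -- minimal capacities of the sVPND tree solution on T (b ≡ 1):
    -- u(e) = 0 off T, and for a tree edge e the minimum over the two
    -- components of T - e of the number of terminals in it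
    IsTreeCapacity : Pred (Fin m) 0ℓ → (Fin m → ℕ) → Set
    IsTreeCapacity ET u =
      ∀ e → (¬ ET e → u e ≡ 0)
          × (ET e → ∀ S₁ S₂ → IsTerminalSide ET e (src e) S₁ →
                    IsTerminalSide ET e (tgt e) S₂ → u e ≡ ∣ S₁ ∣ ⊓ ∣ S₂ ∣)

module _ {a ℓ : Level} (M : CommutativeMonoid a ℓ) where
  open CommutativeMonoid M using (Carrier; rawMonoid)
  open RM rawMonoid using (sum) renaming (_×_ to _·_)

  cost : ∀ {m} → (Fin m → Carrier) → (Fin m → ℕ) → Carrier
  cost c x = sum (λ e → x e · c e)

-- Let T be a terminal subtree and P a family of simple i-j paths in T.  For a
-- tree edge e = xy, deleting e splits T into the part reachable from x and
-- the part reachable from y (disjoint by acyclicity, exhaustive by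
-- connectivity).  Say i lies on x's side.  A simple tree path from i uses e
-- iff it ends on y's side, so the terminals counted by n(e, P) are exactly
-- the terminals B on y's side, the others A = W ∖ B are those on x's side,
-- and y(e, P) = min(|B|, k - |B|) = min(|B|, |A|) = u(e).  Off the tree both
-- u(e) and n(e, P) vanish, so the costs agree edge by edge.  Conversely the
-- paths of a PR tree solution form a terminal subtree containing them.

module Submission where

open import Defs
open import Level using (0ℓ)
open import Function using (id; _∘_)
open import Data.Empty using (⊥; ⊥-elim)
open import Data.Product using (Σ; _×_; _,_; proj₁; proj₂)
import Data.Product as Prod
open import Data.Sum using (_⊎_; inj₁; inj₂; [_,_])
import Data.Sum as Sum
open import Data.Nat using (ℕ; zero; suc; _+_; _∸_; _⊓_; _≤_; z≤n; s≤s; _≡ᵇ_)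
import Data.Nat as ℕ
open import Data.Nat.Properties using (+-suc; ⊓-comm; m+n∸n≡m)
open import Data.Nat.ListAction using () renaming (sum to sumᴸ)
open import Data.Fin using (Fin; zero; suc)
open import Data.Fin.Properties using (_≟_)
open import Data.Fin.Subset using (Subset; ∣_∣; inside; outside; _─_; Empty)
  renaming (_∈_ to _∈ₛ_; _⊆_ to _⊆ₛ_)
open import Data.Fin.Subset.Properties
  using (drop-∷-⊆; p─q⊆p; x∈p∧x∉q⇒x∈p─q; Empty-unique; ∣⊥∣≡0) renaming (_∈?_ to _∈ₛ?_)
import Data.Vec as V
import Data.Vec.Properties as VP
open import Data.Vec.Base using (here; there)
open import Data.List using () renaming (map to mapᴸ)
open import Data.List.Base using (allFin; tabulate)
open import Data.List.Properties using (map-tabulate)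
open import Data.List.Membership.Propositional using (_∈_; _∉_)
open import Data.List.Relation.Unary.Any using (here; there)
import Data.List.Relation.Unary.Any as Any
open import Data.List.Relation.Unary.All using (All)
import Data.List.Relation.Unary.All as All
open import Data.List.Relation.Unary.All.Properties using (¬Any⇒All¬)
open import Data.List.Relation.Unary.AllPairs using ([]; _∷_)
open import Relation.Nullary using (¬_; yes; no)
open import Relation.Nullary.Decidable using (decidable-stable)
open import Relation.Unary using (Pred)
open import Relation.Binary.PropositionalEquality
  using (_≡_; _≢_; refl; sym; trans; cong; subst; module ≡-Reasoning)
open import Algebra.Bundles using (CommutativeMonoid)
import Algebra.Definitions.RawMonoid as RM
import Algebra.Properties.Monoid.Sum

ones : ∀ {n} → (Fin n → ℕ) → Subset n
ones f = V.tabulate (λ j → f j ≡ᵇ 1)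

lookup-ones : ∀ {n} (f : Fin n → ℕ) j → V.lookup (ones f) j ≡ (f j ≡ᵇ 1)
lookup-ones f j = VP.lookup∘tabulate (λ j → f j ≡ᵇ 1) j

∈ones⇒≡1 : ∀ {n} (f : Fin n → ℕ) {j} → j ∈ₛ ones f → f j ≡ 1
∈ones⇒≡1 f {j} j∈ with f j | trans (sym (lookup-ones f j)) (VP.[]=⇒lookup j∈)
... | 1           | _  = refl
... | 0           | ()
... | suc (suc _) | ()

≡1⇒∈ones : ∀ {n} (f : Fin n → ℕ) {j} → f j ≡ 1 → j ∈ₛ ones f
≡1⇒∈ones f {j} f≡1 =
  VP.lookup⇒[]= j (ones f) (trans (lookup-ones f j) (cong (_≡ᵇ 1) f≡1))

sum≡∣ones∣ : ∀ {n} (f : Fin n → ℕ) → (∀ j → f j ≤ 1) → sumᴸ (mapᴸ f (allFin n)) ≡ ∣ ones f ∣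
sum≡∣ones∣ f f≤1 = trans (cong sumᴸ (map-tabulate id f)) (tabulated f f≤1)
  where
  tabulated : ∀ {n} (f : Fin n → ℕ) → (∀ j → f j ≤ 1) → sumᴸ (tabulate f) ≡ ∣ ones f ∣
  tabulated {zero}  f f≤1 = refl
  tabulated {suc n} f f≤1 with f zero | f≤1 zero | tabulated (f ∘ suc) (f≤1 ∘ suc)
  ... | 0 | _       | ih = ih
  ... | 1 | s≤s z≤n | ih = cong suc ih

∣p∣≡∣p─q∣+∣q∣ : ∀ {n} (p q : Subset n) → q ⊆ₛ p → ∣ p ∣ ≡ ∣ p ─ q ∣ + ∣ q ∣
∣p∣≡∣p─q∣+∣q∣ V.[]            V.[]            q⊆p = refl
∣p∣≡∣p─q∣+∣q∣ (inside  V.∷ p) (inside  V.∷ q) q⊆p =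
  trans (cong suc (∣p∣≡∣p─q∣+∣q∣ p q (drop-∷-⊆ q⊆p))) (sym (+-suc ∣ p ─ q ∣ ∣ q ∣))
∣p∣≡∣p─q∣+∣q∣ (inside  V.∷ p) (outside V.∷ q) q⊆p = cong suc (∣p∣≡∣p─q∣+∣q∣ p q (drop-∷-⊆ q⊆p))
∣p∣≡∣p─q∣+∣q∣ (outside V.∷ p) (outside V.∷ q) q⊆p = ∣p∣≡∣p─q∣+∣q∣ p q (drop-∷-⊆ q⊆p)
∣p∣≡∣p─q∣+∣q∣ (outside V.∷ p) (inside  V.∷ q) q⊆p with q⊆p here
... | ()

x∈p─q⇒x∉q : ∀ {n} {x : Fin n} (p q : Subset n) → x ∈ₛ p ─ q → ¬ x ∈ₛ q
x∈p─q⇒x∉q (inside V.∷ p) (outside V.∷ q) here       ()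
x∈p─q⇒x∉q (_      V.∷ p) (_       V.∷ q) (there x∈) (there x∈q) = x∈p─q⇒x∉q p q x∈ x∈q

-- Walks, reachability inside an edge set, and simple walks

module Walks (G : Graph) where
  open Graph G
  open import Data.List.Membership.DecPropositional (_≟_ {n}) using () renaming (_∈?_ to _∈ⱽ?_)

  joins-sym : ∀ {e u v} → Joins G e u v → Joins G e v u
  joins-sym (inj₁ uv) = inj₂ uv
  joins-sym (inj₂ vu) = inj₁ vu

  joins-unique : ∀ {e a b x y} → Joins G e a b → Joins G e x y →
                 (a ≡ x × b ≡ y) ⊎ (a ≡ y × b ≡ x)
  joins-unique (inj₁ (p , q)) (inj₁ (r , s)) = inj₁ (trans (sym p) r , trans (sym q) s)
  joins-unique (inj₁ (p , q)) (inj₂ (r , s)) = inj₂ (trans (sym p) r , trans (sym q) s)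
  joins-unique (inj₂ (p , q)) (inj₁ (r , s)) = inj₂ (trans (sym q) s , trans (sym p) r)
  joins-unique (inj₂ (p , q)) (inj₂ (r , s)) = inj₁ (trans (sym q) s , trans (sym p) r)

  _++ʷ_ : ∀ {u v w} → Walk G u v → Walk G v w → Walk G u w
  []           ++ʷ q = q
  step e j p   ++ʷ q = step e j (p ++ʷ q)

  edges-++ : ∀ {u v w} (p : Walk G u v) (q : Walk G v w) {e} →
             e ∈ edgesOf G (p ++ʷ q) → e ∈ edgesOf G p ⊎ e ∈ edgesOf G q
  edges-++ []           q e∈            = inj₂ e∈
  edges-++ (step f j p) q (here refl)   = inj₁ (here refl)
  edges-++ (step f j p) q (there e∈)    = Sum.map₁ there (edges-++ p q e∈)

  reverse : ∀ {u w} → Walk G u w → Walk G w u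
  reverse []           = []
  reverse (step e j p) = reverse p ++ʷ step e (joins-sym j) []

  edges-reverse : ∀ {u w} (p : Walk G u w) {e} → e ∈ edgesOf G (reverse p) → e ∈ edgesOf G p
  edges-reverse (step f j p) e∈ with edges-++ (reverse p) (step f (joins-sym j) []) e∈
  ... | inj₁ e∈p         = there (edges-reverse p e∈p)
  ... | inj₂ (here refl) = here refl

  Reach : Pred (Fin m) 0ℓ → Fin n → Fin n → Set
  Reach F u w = Σ (Walk G u w) (WalkIn G F)

  reach-refl : ∀ {F v} → Reach F v v
  reach-refl = [] , λ ()

  reach-edge : ∀ {F e u v} → F e → Joins G e u v → Reach F u v
  reach-edge Fe j = step _ j [] , λ { (here refl) → Fe }

  reach-trans : ∀ {F u v w} → Reach F u v → Reach F v w → Reach F u w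
  reach-trans (p , Fp) (q , Fq) = p ++ʷ q , [ Fp , Fq ] ∘ edges-++ p q

  reach-sym : ∀ {F u w} → Reach F u w → Reach F w u
  reach-sym (p , Fp) = reverse p , Fp ∘ edges-reverse p

  _∖_ : Pred (Fin m) 0ℓ → Fin m → Pred (Fin m) 0ℓ
  (F ∖ e) f = F f × f ≢ e

  start∈ : ∀ {u w} (p : Walk G u w) → u ∈ vertsOf G p
  start∈ []           = here refl
  start∈ (step _ _ _) = here refl

  end∈ : ∀ {u w} (p : Walk G u w) → w ∈ vertsOf G p
  end∈ []           = here refl
  end∈ (step _ _ p) = there (end∈ p)

  endpoints∈ : ∀ {e u w} (p : Walk G u w) → e ∈ edgesOf G p →
               src e ∈ vertsOf G p × tgt e ∈ vertsOf G p
  endpoints∈ (step f (inj₁ (s , t)) p) (here refl) = here s , there (subst (_∈ vertsOf G p) (sym t) (start∈ p))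
  endpoints∈ (step f (inj₂ (s , t)) p) (here refl) = there (subst (_∈ vertsOf G p) (sym s) (start∈ p)) , here t
  endpoints∈ (step f j p)              (there e∈)  = Prod.map there there (endpoints∈ p e∈)

  edge∉walk : ∀ {e x v u w} → Joins G e x v → (p : Walk G u w) →
              All (x ≢_) (vertsOf G p) → e ∉ edgesOf G p
  edge∉walk (inj₁ (s , _)) p x∉p e∈p = All.lookup x∉p (subst (_∈ vertsOf G p) s (proj₁ (endpoints∈ p e∈p))) refl
  edge∉walk (inj₂ (_ , t)) p x∉p e∈p = All.lookup x∉p (subst (_∈ vertsOf G p) t (proj₂ (endpoints∈ p e∈p))) refl

  prefix : ∀ {u w x} (p : Walk G u w) → x ∈ vertsOf G p →
           Σ (Walk G u x) (λ q → ∀ {e} → e ∈ edgesOf G q → e ∈ edgesOf G p)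
  prefix []           (here refl) = [] , λ ()
  prefix (step e j p) (here refl) = [] , λ ()
  prefix (step e j p) (there x∈)  with prefix p x∈
  ... | q , q⊆p = step e j q , λ { (here refl) → here refl ; (there f∈) → there (q⊆p f∈) }

  suffix : ∀ {u w x} (p : Walk G u w) → x ∈ vertsOf G p →
           Σ (Walk G x w) (λ q → (IsSimple G p → IsSimple G q) × (∀ {e} → e ∈ edgesOf G q → e ∈ edgesOf G p))
  suffix []           (here refl) = [] , id , id
  suffix (step e j p) (here refl) = step e j p , id , id
  suffix (step e j p) (there x∈)  with suffix p x∈
  ... | q , simple , q⊆p = q , (λ { (_ ∷ sp) → simple sp }) , there ∘ q⊆p

  simplify : ∀ {u w} (p : Walk G u w) →
             Σ (Walk G u w) (λ q → IsSimple G q × (∀ {e} → e ∈ edgesOf G q → e ∈ edgesOf G p))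
  simplify []                        = [] , (All.[] ∷ []) , λ ()
  simplify {u} (step e j p) with simplify p
  ... | q , sq , q⊆p with u ∈ⱽ? vertsOf G q
  ...   | yes u∈q = let (r , sr , r⊆q) = suffix q u∈q in r , sr sq , there ∘ q⊆p ∘ r⊆q
  ...   | no  u∉q = step e j q , ¬Any⇒All¬ (vertsOf G q) u∉q ∷ sq ,
                    λ { (here refl) → here refl ; (there f∈) → there (q⊆p f∈) }

  simple-reach : ∀ {F u w} → Reach F u w → Σ (Walk G u w) (λ q → IsSimple G q × WalkIn G F q)
  simple-reach (p , Fp) = let (q , sq , q⊆p) = simplify p in q , sq , Fp ∘ q⊆p

  -- a walk from u ends either in the (F ∖ e)-component of u or in that of
  -- an endpoint of e, according to whether it never or last used e
  last-exit : ∀ {F e x y u w} → Joins G e x y → (p : Walk G u w) → WalkIn G F p →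
              Reach (F ∖ e) u w ⊎ (Reach (F ∖ e) x w ⊎ Reach (F ∖ e) y w)
  last-exit jxy [] _ = inj₁ reach-refl
  last-exit {e = e} jxy (step f jf p) Fp with last-exit jxy p (Fp ∘ there) | f ≟ e
  ... | inj₂ r | _      = inj₂ r
  ... | inj₁ r | no f≢e = inj₁ (reach-trans (reach-edge (Fp (here refl) , f≢e) jf) r)
  ... | inj₁ r | yes refl with joins-unique jf jxy
  ...   | inj₁ (_ , refl) = inj₂ (inj₂ r)
  ...   | inj₂ (_ , refl) = inj₂ (inj₁ r)

  split : ∀ {F e u w} (p : Walk G u w) → IsSimple G p → WalkIn G F p → e ∈ edgesOf G p →
          Σ (Fin n) λ a → Σ (Fin n) λ b → Joins G e a b × Reach (F ∖ e) u a × Reach (F ∖ e) b w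
  split {e = e} (step f jf p) (u∉p ∷ sp) Fp e∈ with f ≟ e
  ... | yes refl = _ , _ , jf , reach-refl , (p , λ g∈ → Fp (there g∈) , λ { refl → edge∉walk jf p u∉p g∈ })
  ... | no f≢e with split p sp (Fp ∘ there) (Any.tail (f≢e ∘ sym) e∈)
  ...   | a , b , jab , ua , bw = a , b , jab , reach-trans (reach-edge (Fp (here refl) , f≢e) jf) ua , bw

  -- Removing a tree edge e = xy splits the tree into exactly two sides:
  -- the vertices reachable from x, and those reachable from y, in T ∖ e.

  module TreeMinusEdge {VT ET} (T : IsTree G VT ET) {e x y} (eT : ET e) (jxy : Joins G e x y) where
    open IsTree T

    Side : Fin n → Fin n → Set
    Side = Reach (ET ∖ e)

    -- a vertex on both sides would close a cycle through e
    sides-disjoint : ∀ {w} → Side x w → Side y w → ⊥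
    sides-disjoint xw yw with simple-reach (reach-trans yw (reach-sym xw))
    ... | q , sq , Fq = acyclic eT jxy q sq (proj₁ ∘ Fq) (λ e∈q → proj₂ (Fq e∈q) refl)

    x∈T : VT x
    x∈T = start∈T jxy
      where
      start∈T : ∀ {v} → Joins G e x v → VT x
      start∈T (inj₁ (s , _)) = subst VT s (proj₁ (closed eT))
      start∈T (inj₂ (_ , t)) = subst VT t (proj₂ (closed eT))

    sides-cover : ∀ {w} → VT w → Side x w ⊎ Side y w
    sides-cover w∈T with connected x∈T w∈T
    ... | p , Tp with last-exit jxy p Tp
    ...   | inj₁ xw = inj₁ xw
    ...   | inj₂ xw⊎yw = xw⊎yw

    crossing : ∀ {u w} (p : Walk G u w) → IsSimple G p → WalkIn G ET p → e ∈ edgesOf G p →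
               Side x u → Side y w
    crossing p sp Tp e∈p xu with split p sp Tp e∈p
    ... | a , b , jab , ua , bw with joins-unique jab jxy
    ...   | inj₁ (_ , refl) = bw
    ...   | inj₂ (refl , _) = ⊥-elim (sides-disjoint xu (reach-sym ua))

    staying : ∀ {u w} (p : Walk G u w) → WalkIn G ET p → e ∉ edgesOf G p →
              Side x u → Side x w
    staying p Tp e∉p xu = reach-trans xu (p , λ f∈p → Tp f∈p , λ { refl → e∉p f∈p })

-- Pyramidal routing on a tree

module Routing (G : Graph) (W : Subset (Graph.n G)) (i : Fin (Graph.n G)) where
  open Graph G
  open Walks G
  open Instance G W i
  open import Data.List.Membership.DecPropositional (_≟_ {m}) using () renaming (_∈?_ to _∈ᴸ?_)

  data UsesView (P : PathFamily) (e : Fin m) (j : Fin n) : ℕ → Set where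
    on-path  : ∀ jW ji → e ∈ edgesOf G (P j jW ji) → UsesView P e j 1
    off-path : ∀ jW ji → e ∉ edgesOf G (P j jW ji) → UsesView P e j 0
    excluded : ¬ (j ∈ₛ W) ⊎ j ≡ i → UsesView P e j 0

  usesView : ∀ P e j → UsesView P e j (uses P e j)
  usesView P e j with j ∈ₛ? W | j ≟ i
  ... | yes jW | no ji with e ∈ᴸ? edgesOf G (P j jW ji)
  ...   | yes e∈ = on-path jW ji e∈
  ...   | no  e∉ = off-path jW ji e∉
  usesView P e j | yes _  | yes j≡i = excluded (inj₂ j≡i)
  usesView P e j | no j∉W | _       = excluded (inj₁ j∉W)

  uses≤1 : ∀ P e j → uses P e j ≤ 1
  uses≤1 P e j with uses P e j | usesView P e j
  ... | _ | on-path  _ _ _ = s≤s z≤n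
  ... | _ | off-path _ _ _ = z≤n
  ... | _ | excluded _     = z≤n

  uses-on-path : ∀ P e {j} → uses P e j ≡ 1 → Σ (j ∈ₛ W) λ jW → Σ (j ≢ i) λ ji → e ∈ edgesOf G (P j jW ji)
  uses-on-path P e {j} u≡1 with uses P e j | usesView P e j
  uses-on-path P e refl | _ | on-path jW ji e∈ = jW , ji , e∈

  nLoad≡∣ones∣ : ∀ P e → nLoad P e ≡ ∣ ones (uses P e) ∣
  nLoad≡∣ones∣ P e = sum≡∣ones∣ (uses P e) (uses≤1 P e)

  module _ {VT ET} (T : IsTree G VT ET) (terminals∈T : ∀ {w} → w ∈ₛ W → VT w) (iW : i ∈ₛ W)
           (P : PathFamily) (simple : IsPRSolution P) (P⊆T : FamilyIn ET P) where

    -- For a tree edge e = xy with i on x's side, the terminals whose path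
    -- uses e are exactly the terminals on y's side.
    module EdgeLoad {e x y} (eT : ET e) (jxy : Joins G e x y) (xi : Reach (ET ∖ e) x i) where
      open TreeMinusEdge T eT jxy

      Bʸ : Subset n
      Bʸ = ones (uses P e)

      Aˣ : Subset n
      Aˣ = W ─ Bʸ

      Bʸ⇒y-side : ∀ {w} → w ∈ₛ Bʸ → w ∈ₛ W × Side y w
      Bʸ⇒y-side w∈B with uses-on-path P e (∈ones⇒≡1 (uses P e) w∈B)
      ... | jW , ji , e∈ = jW , crossing (P _ jW ji) (simple _ jW ji) (P⊆T _ jW ji) e∈ xi

      y-side⇒Bʸ : ∀ {w} → w ∈ₛ W → Side y w → w ∈ₛ Bʸ
      -- the value  uses P e w  is abstracted together with the lemma
      -- turning its being 1 into membership in Bʸ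
      y-side⇒Bʸ {w} wW yw with uses P e w | usesView P e w | ≡1⇒∈ones (uses P e) {w}
      ... | _ | on-path _ _ _          | ∈B = ∈B refl
      ... | _ | off-path jW ji e∉      | _  =
        ⊥-elim (sides-disjoint (staying (P w jW ji) (P⊆T w jW ji) e∉ xi) yw)
      ... | _ | excluded (inj₁ w∉W)    | _  = ⊥-elim (w∉W wW)
      ... | _ | excluded (inj₂ refl)   | _  = ⊥-elim (sides-disjoint xi yw)

      Bʸ-side : IsTerminalSide ET e y Bʸ
      Bʸ-side w = Bʸ⇒y-side , λ (wW , yw) → y-side⇒Bʸ wW yw

      Aˣ-side : IsTerminalSide ET e x Aˣ
      Aˣ-side w = to , from
        where
        to : w ∈ₛ Aˣ → w ∈ₛ W × Side x w
        to w∈A with p─q⊆p W Bʸ w∈A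
        ... | wW with sides-cover (terminals∈T wW)
        ...   | inj₁ xw = wW , xw
        ...   | inj₂ yw = ⊥-elim (x∈p─q⇒x∉q W Bʸ w∈A (y-side⇒Bʸ wW yw))
        from : w ∈ₛ W × Side x w → w ∈ₛ Aˣ
        from (wW , xw) = x∈p∧x∉q⇒x∈p─q wW (λ w∈B → sides-disjoint xw (proj₂ (Bʸ⇒y-side w∈B)))

      yLoad≡min : yLoad P e ≡ ∣ Bʸ ∣ ⊓ ∣ Aˣ ∣
      yLoad≡min = begin
        nLoad P e ⊓ (k ∸ nLoad P e)        ≡⟨ cong (λ t → t ⊓ (k ∸ t)) (nLoad≡∣ones∣ P e) ⟩
        ∣ Bʸ ∣ ⊓ (∣ W ∣ ∸ ∣ Bʸ ∣)           ≡⟨ cong (λ t → ∣ Bʸ ∣ ⊓ (t ∸ ∣ Bʸ ∣)) (∣p∣≡∣p─q∣+∣q∣ W Bʸ (proj₁ ∘ Bʸ⇒y-side)) ⟩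
        ∣ Bʸ ∣ ⊓ (∣ Aˣ ∣ + ∣ Bʸ ∣ ∸ ∣ Bʸ ∣)  ≡⟨ cong (∣ Bʸ ∣ ⊓_) (m+n∸n≡m ∣ Aˣ ∣ ∣ Bʸ ∣) ⟩
        ∣ Bʸ ∣ ⊓ ∣ Aˣ ∣                     ∎
        where open ≡-Reasoning

    -- on a tree edge the minimal capacity equals the PR load y(e, P); the
    -- source i lies on the side of src e or of tgt e, which fixes x and y
    capacity-on-tree : ∀ {u} → IsTreeCapacity ET u → ∀ {e} → ET e → u e ≡ yLoad P e
    capacity-on-tree cap {e} eT with TreeMinusEdge.sides-cover T eT (inj₁ (refl , refl)) (terminals∈T iW)
    ... | inj₁ src⇝i = let open EdgeLoad eT (inj₁ (refl , refl)) src⇝i in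
      trans (proj₂ (cap e) eT Aˣ Bʸ Aˣ-side Bʸ-side) (trans (⊓-comm ∣ Aˣ ∣ ∣ Bʸ ∣) (sym yLoad≡min))
    ... | inj₂ tgt⇝i = let open EdgeLoad eT (inj₂ (refl , refl)) tgt⇝i in
      trans (proj₂ (cap e) eT Bʸ Aˣ Bʸ-side Aˣ-side) (sym yLoad≡min)

    -- off the tree no path uses e, so both sides vanish
    capacity-off-tree : ∀ {u} → IsTreeCapacity ET u → ∀ {e} → ¬ ET e → u e ≡ yLoad P e
    capacity-off-tree cap {e} e∉T = trans (proj₁ (cap e) e∉T) (sym (cong (λ t → t ⊓ (k ∸ t)) nLoad≡0))
      where
      nLoad≡0 : nLoad P e ≡ 0
      nLoad≡0 = trans (nLoad≡∣ones∣ P e) (trans (cong ∣_∣ (Empty-unique unused)) (∣⊥∣≡0 n))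
        where
        unused : Empty (ones (uses P e))
        unused (j , j∈) with uses-on-path P e (∈ones⇒≡1 (uses P e) j∈)
        ... | jW , ji , e∈ = e∉T (P⊆T j jW ji e∈)

    -- membership of e in the tree need not be decidable, but equality of
    -- naturals is, so the two cases combine by double-negation stability
    capacity≡yLoad : ∀ {u} → IsTreeCapacity ET u → ∀ e → u e ≡ yLoad P e
    capacity≡yLoad cap e = decidable-stable (_ ℕ.≟ _)
      λ u≢y → u≢y (capacity-off-tree cap (λ eT → u≢y (capacity-on-tree cap eT)))

  path-tree : ∀ {VT ET} → IsTree G VT ET → ∀ P → FamilyIn ET P → IsTree G (pathVerts P) (pathEdges P)
  path-tree {ET = ET} T P P⊆T = record
    { nonempty  = i , inj₁ refl
    ; closed    = λ (j , jW , ji , e∈) → let (s∈ , t∈) = endpoints∈ (P j jW ji) e∈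
                                         in inj₂ (j , jW , ji , s∈) , inj₂ (j , jW , ji , t∈)
    ; connected = λ v∈ w∈ → reach-trans (to-i v∈) (reach-sym (to-i w∈))
    ; acyclic   = λ eP j p sp Pp e∉p → IsTree.acyclic T (in-T eP) j p sp (in-T ∘ Pp) e∉p
    }
    where
    in-T : ∀ {f} → pathEdges P f → ET f
    in-T (j , jW , ji , f∈) = P⊆T j jW ji f∈
    to-i : ∀ {v} → pathVerts P v → Reach (pathEdges P) v i
    to-i (inj₁ refl) = reach-refl
    to-i (inj₂ (j , jW , ji , v∈)) = let (q , q⊆P) = prefix (P j jW ji) v∈
                                     in reach-sym (q , λ f∈ → j , jW , ji , q⊆P f∈)

cost-cong : ∀ {a ℓ} (M : CommutativeMonoid a ℓ) {m} (c : Fin m → CommutativeMonoid.Carrier M)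
            {x y : Fin m → ℕ} → (∀ e → x e ≡ y e) → CommutativeMonoid._≈_ M (cost M c x) (cost M c y)
cost-cong M c x≗y = reflexive (sum-cong-≗ (λ e → cong (_· c e) (x≗y e)))
  where
  open CommutativeMonoid M using (monoid; reflexive; rawMonoid)
  open Algebra.Properties.Monoid.Sum monoid using (sum-cong-≗)
  open RM rawMonoid using () renaming (_×_ to _·_)

module Correspondence {a ℓ} (M : CommutativeMonoid a ℓ) (G : Graph)
                      (c : Fin (Graph.m G) → CommutativeMonoid.Carrier M)
                      (W : Subset (Graph.n G)) (i : Fin (Graph.n G)) (iW : i ∈ₛ W) where
  open CommutativeMonoid M using (_≈_)
  open Walks G
  open Instance G W i
  open Routing G W i

  sVPND⇒PR : ∀ VT ET → IsTerminalSubtree VT ET →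
             Σ PathFamily (λ P → IsPRSolution P × FamilyIn ET P)
             × (∀ P → IsPRSolution P → FamilyIn ET P →
                  IsPRTreeSolution P
                  × (∀ u → IsTreeCapacity ET u → cost M c u ≈ cost M c (yLoad P)))
  sVPND⇒PR VT ET (T , W⊆T) = tree-paths , λ P simple P⊆T →
      (simple , path-tree T P P⊆T) , λ u cap → cost-cong M c (capacity≡yLoad T W⊆T iW P simple P⊆T cap)
    where
    path-to : ∀ j → j ∈ₛ W → Σ (Walk G i j) (λ q → IsSimple G q × WalkIn G ET q)
    path-to j jW = simple-reach (IsTree.connected T (W⊆T iW) (W⊆T jW))

    tree-paths : Σ PathFamily (λ P → IsPRSolution P × FamilyIn ET P)
    tree-paths = (λ j jW _ → proj₁ (path-to j jW))
               , (λ j jW _ → proj₁ (proj₂ (path-to j jW)))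
               , (λ j jW _ → proj₂ (proj₂ (path-to j jW)))

  PR⇒sVPND : ∀ P → IsPRTreeSolution P →
             IsTerminalSubtree (pathVerts P) (pathEdges P)
             × FamilyIn (pathEdges P) P
             × (∀ u → IsTreeCapacity (pathEdges P) u → cost M c u ≈ cost M c (yLoad P))
  PR⇒sVPND P (simple , T) =
      (T , W⊆T) , P⊆T , λ u cap → cost-cong M c (capacity≡yLoad T W⊆T iW P simple P⊆T cap)
    where
    P⊆T : FamilyIn (pathEdges P) P
    P⊆T j jW ji f∈ = j , jW , ji , f∈

    W⊆T : ∀ {w} → w ∈ₛ W → pathVerts P w
    W⊆T {w} wW with w ≟ i
    ... | yes w≡i = inj₁ w≡i
    ... | no  w≢i = inj₂ (w , wW , w≢i , end∈ (P w wW w≢i))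

lemma2 : ∀ {a ℓ} (M : CommutativeMonoid a ℓ) (G : Graph)
         (c : Fin (Graph.m G) → CommutativeMonoid.Carrier M)
         (W : Subset (Graph.n G)) (i : Fin (Graph.n G)) → i ∈ₛ W →
         let open Instance G W i
             open CommutativeMonoid M using (_≈_)
         in
         -- sVPND tree solution on a terminal subtree T  ⟹  PR tree solution of the same cost
         (∀ VT ET → IsTerminalSubtree VT ET →
            Σ PathFamily (λ P → IsPRSolution P × FamilyIn ET P)
            × (∀ P → IsPRSolution P → FamilyIn ET P →
                 IsPRTreeSolution P
                 × (∀ u → IsTreeCapacity ET u → cost M c u ≈ cost M c (yLoad P))))
         -- PR tree solution  ⟹  it arises from the tree T formed by its paths, same cost
         × (∀ P → IsPRTreeSolution P →
              IsTerminalSubtree (pathVerts P) (pathEdges P)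
              × FamilyIn (pathEdges P) P
              × (∀ u → IsTreeCapacity (pathEdges P) u → cost M c u ≈ cost M c (yLoad P)))
lemma2 M G c W i iW = sVPND⇒PR , PR⇒sVPND
  where open Correspondence M G c W i iW
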